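{- Let $G^g,H^h$ be games with activeness. If $G^g=H^h$, then $\mathcal{G}^{\bm{\gamma}}(G^g)=\mathcal{G}^{\bm{\gamma}}(H^h)$ for every $\bm{\gamma}\in\{0,1\}^{\infty}$.
   Context: Let $\mathcal{B}=\{0,1\}$. Define $\mathbb{I}_0=\{\emptyset\}\times\mathcal{B}$ and $\mathbb{I}_n=2^{\mathbb{I}_{n-1}}\times\mathcal{B}$ for $n\ge1$; a game with activeness is an element of $\mathbb{I}=\bigcup_{n\ge0}\mathbb{I}_n$. A pair $(G,g)$ is written $G^g$; elements of $G$ are its options, $g=1$ meaning active. The outcome $o$ is defined recursively: $o(G^g)=\mathscr{N}$ if $g=1$ and some option has outcome $\mathscr{P}$, and $o(G^g)=\mathscr{P}$ otherwise. The sum is $G^g+H^h=(\{G'^{g'}+H^h:G'^{g'}\in G^g\}\cup\{G^g+H'^{h'}:H'^{h'}\in H^h\})^{\max\{g,h\}}$. $G^g=H^h$ means $o(G^g+X^x)=o(H^h+X^x)$ for all games $X^x$. For $\bm{\gamma}\in\mathcal{B}^\infty$, ${\ast}^{\bm{\gamma}}i=\{{\ast}^{\bm{\gamma}}j:0\le j<i\}^{\gamma_i}$ recursively, and $\mathcal{G}^{\bm{\gamma}}(G^g)=\{n\in\mathbb{Z}_{\ge0}:o(G^g+{\ast}^{\bm{\gamma}}n)=\mathscr{P}\}$. -}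

module Defs where

open import Data.Bool using (Bool; true; false; _∨_)
open import Data.List using (List; []; _∷_; _++_)
open import Data.Nat using (ℕ; zero; suc)
open import Relation.Binary.PropositionalEquality using (_≡_)

-- A game with activeness G^g: a finite collection of options and an activeness bit.
-- (Each 𝕀_n is finite, so option sets are finite; we represent them by lists.
--  Outcome, sum and everything below are invariant under reordering/duplication.)
data Game : Set where
  _^_ : List Game → Bool → Game

data Outcome : Set where
  𝒩 𝒫 : Outcome

mutual
  o : Game → Outcome
  o (Gs ^ false) = 𝒫
  o (Gs ^ true) with someP Gs
  ... | true  = 𝒩
  ... | false = 𝒫

  someP : List Game → Bool
  someP [] = false
  someP (G ∷ Gs) with o G
  ... | 𝒫 = true
  ... | 𝒩 = someP Gs

mutual
  _⊕_ : Game → Game → Game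
  (Gs ^ g) ⊕ (Hs ^ h) = (leftMoves Gs (Hs ^ h) ++ rightMoves (Gs ^ g) Hs) ^ (g ∨ h)

  leftMoves : List Game → Game → List Game
  leftMoves [] H = []
  leftMoves (G′ ∷ Gs) H = (G′ ⊕ H) ∷ leftMoves Gs H

  rightMoves : Game → List Game → List Game
  rightMoves G [] = []
  rightMoves G (H′ ∷ Hs) = (G ⊕ H′) ∷ rightMoves G Hs

_≈_ : Game → Game → Set
G ≈ H = ∀ (X : Game) → o (G ⊕ X) ≡ o (H ⊕ X)

Seq : Set
Seq = ℕ → Bool

mutual
  star : Seq → ℕ → Game
  star γ i = starsBelow γ i ^ γ i

  starsBelow : Seq → ℕ → List Game
  starsBelow γ zero = []
  starsBelow γ (suc j) = star γ j ∷ starsBelow γ j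

_∈𝒢[_]_ : ℕ → Seq → Game → Set
n ∈𝒢[ γ ] G = o (G ⊕ star γ n) ≡ 𝒫

module Submission where

open import Defs
open import Data.Nat using (ℕ)
open import Function.Bundles using (_⇔_; mk⇔)
open import Relation.Binary.PropositionalEquality using (_≡_; trans; sym)

theorem3p21 : (G H : Game) → G ≈ H →
    (γ : Seq) → (n : ℕ) → (n ∈𝒢[ γ ] G) ⇔ (n ∈𝒢[ γ ] H)
theorem3p21 G H G≈H γ n = mk⇔ (trans (sym same-outcome)) (trans same-outcome)
  where
  same-outcome : o (G ⊕ star γ n) ≡ o (H ⊕ star γ n)
  same-outcome = G≈H (star γ n)
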